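{- Let $n\ge 7$ and let $N=\overline{c_1\dots c_{n-6}aaaaab}$ be an $n$-digit absolute prime whose last six digits are five digits $a$ followed by a digit $b$, where $a\neq b$. Then the integer $K=\overline{c_1\dots c_{n-6}}$ is divisible by $7$.
   Context: An absolute prime is a positive integer which is prime and remains prime after an arbitrary permutation of the digits of its decimal representation. The notation $\overline{a_1\dots a_m}$ denotes $a_110^{m-1}+a_210^{m-2}+\dots+a_{m-1}10+a_m$ for decimal digits $a_1,\dots,a_m$. -}

module Defs where

open import Data.Nat using (ℕ; _+_; _*_)
open import Data.Fin using (Fin; toℕ)
open import Data.List using (List; foldl)
open import Data.Nat.Primality using (Prime)
open import Data.List.Relation.Binary.Permutation.Propositional using (_↭_)

Digit : Set
Digit = Fin 10

-- value [a₁, …, aₘ] = a₁·10^(m-1) + … + aₘ  (overline notation, most significant digit first)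
value : List Digit → ℕ
value = foldl (λ acc d → acc * 10 + toℕ d) 0

AbsolutePrime : List Digit → Set
AbsolutePrime ds = ∀ es → ds ↭ es → Prime (value es)

-- Every permutation of the digits of N ends in a digit coprime to 10, so a, b ∈ {1, 3, 7, 9}.
-- Let N_j be the rearrangement keeping the prefix K and putting b in the 10^j place of the
-- last six digits. Since 111111 ≡ 0 and 10^6 ≡ 1 (mod 7), N_j ≡ K + (b − a)·10^j (mod 7);
-- as 10 is a primitive root mod 7 and 7 ∤ b − a, these residues for j < 6 run through all
-- classes other than that of K. So if 7 ∤ K, some N_j is a multiple of 7 exceeding 7.
module Submission where

open import Defs
open import Data.Nat using (ℕ; suc; _≥_; _+_; _*_; _^_; _∸_; _<_; _≤_; _%_; _/_; NonZero; s≤s; z≤n)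
open import Data.Nat.Properties
  using ( allUpTo?; m≤m*n; m≤m+n; *-monoˡ-≤; ≤-refl; ≤-trans; <-≤-trans; ≤-<-trans; ≤ᵇ⇒≤; m∸n+n≡m; m^n≢0
        ; +-identityʳ; *-identityʳ; *-identityˡ; ^-monoʳ-<; module ≤-Reasoning)
open import Data.Nat.DivMod using (m≡m%n+[m/n]*n; m%n<n)
open import Data.Nat.Divisibility using (_∣_; _∣?_; ∣-refl; ∣-trans; n∣m*n; ∣m∣n⇒∣m+n; m%n≡0⇒n∣m)
open import Data.Nat.Coprimality using (Coprime; coprime?; prime⇒coprime)
open import Data.Nat.Primality using (Prime)
open import Data.Nat.Tactic.RingSolver using (solve-∀)
open import Data.Fin using (Fin; toℕ; zero) renaming (suc to fsuc)
open import Data.Fin.Properties using (all?; any?; _≟_; toℕ≤pred[n])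
open import Data.List using (List; _∷_; []; _++_; [_]; replicate; foldl; length)
open import Data.List.Properties using (foldl-++; ++-assoc)
open import Data.List.Relation.Binary.Permutation.Propositional using (_↭_; refl; prep; swap; ↭-trans; ↭-sym)
open import Data.List.Relation.Binary.Permutation.Propositional.Properties using (++⁺ˡ; ↭-length)
open import Data.Product using (∃-syntax; _,_; _×_; proj₁; proj₂; uncurry)
open import Relation.Nullary using (¬_; ¬?; contradiction)
open import Relation.Nullary.Decidable using (from-yes; _→-dec_; decidable-stable)
open import Relation.Binary.PropositionalEquality using (_≡_; _≢_; refl; sym; trans; cong; subst; module ≡-Reasoning)

pushDigit : ℕ → Digit → ℕ
pushDigit acc d = acc * 10 + toℕ d

foldl-pushDigit : ∀ acc ds → foldl pushDigit acc ds ≡ acc * 10 ^ length ds + value ds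
foldl-pushDigit acc [] = sym (trans (+-identityʳ (acc * 1)) (*-identityʳ acc))
foldl-pushDigit acc (d ∷ ds) = begin
  foldl pushDigit (acc * 10 + toℕ d) ds             ≡⟨ foldl-pushDigit _ ds ⟩
  (acc * 10 + toℕ d) * 10 ^ length ds + value ds    ≡⟨ regroup acc (toℕ d) (10 ^ length ds) (value ds) ⟩
  acc * 10 ^ length (d ∷ ds) + (toℕ d * 10 ^ length ds + value ds)
    ≡⟨ cong (acc * 10 ^ length (d ∷ ds) +_) (sym (foldl-pushDigit (toℕ d) ds)) ⟩
  acc * 10 ^ length (d ∷ ds) + value (d ∷ ds)       ∎
  where
  open ≡-Reasoning
  regroup : ∀ x y p v → (x * 10 + y) * p + v ≡ x * (10 * p) + (y * p + v)
  regroup = solve-∀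

value-++ : ∀ xs ys → value (xs ++ ys) ≡ value xs * 10 ^ length ys + value ys
value-++ xs ys = trans (foldl-++ pushDigit 0 xs ys) (foldl-pushDigit (value xs) ys)

value-∷-positive : ∀ {d} ds → d ≢ zero → 0 < value (d ∷ ds)
value-∷-positive {zero} ds d≢0 = contradiction refl d≢0
value-∷-positive {d@(fsuc _)} ds _ = ≤-trans (s≤s z≤n)
  (subst (toℕ d ≤_) (sym (foldl-pushDigit (toℕ d) ds))
    (≤-trans (m≤m*n (toℕ d) (10 ^ length ds) {{m^n≢0 10 (length ds)}}) (m≤m+n _ (value ds))))

value-++-≥ : ∀ {d} ds ys → d ≢ zero → 10 ^ length ys ≤ value ((d ∷ ds) ++ ys)
value-++-≥ {d} ds ys d≢0 = begin
  10 ^ length ys                                 ≡⟨ sym (*-identityˡ (10 ^ length ys)) ⟩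
  1 * 10 ^ length ys                             ≤⟨ *-monoˡ-≤ (10 ^ length ys) (value-∷-positive ds d≢0) ⟩
  value (d ∷ ds) * 10 ^ length ys                ≤⟨ m≤m+n _ (value ys) ⟩
  value (d ∷ ds) * 10 ^ length ys + value ys     ≡⟨ sym (value-++ (d ∷ ds) ys) ⟩
  value ((d ∷ ds) ++ ys)                         ∎
  where open ≤-Reasoning

coprime-lastDigit : ∀ ds d → Coprime (value (ds ++ [ d ])) 10 → Coprime (toℕ d) 10
coprime-lastDigit ds d coprime (i∣d , i∣10) =
  coprime (subst (_ ∣_) (sym (value-++ ds [ d ])) (∣m∣n⇒∣m+n (∣-trans i∣10 (n∣m*n (value ds))) i∣d) , i∣10)

∣[m%d]*k+t⇒∣m*k+t : ∀ m k t d .{{_ : NonZero d}} → d ∣ m % d * k + t → d ∣ m * k + t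
∣[m%d]*k+t⇒∣m*k+t m k t d d∣ = subst (d ∣_) (sym m*k+t≡) (∣m∣n⇒∣m+n d∣ (n∣m*n (m / d * k)))
  where
  regroup : ∀ r q d k t → (r + q * d) * k + t ≡ (r * k + t) + q * k * d
  regroup = solve-∀
  m*k+t≡ : m * k + t ≡ (m % d * k + t) + m / d * k * d
  m*k+t≡ = trans (cong (λ x → x * k + t) (m≡m%n+[m/n]*n m d)) (regroup (m % d) (m / d) d k t)

replicate-++-↭ : ∀ {A : Set} m n (a b : A) → replicate m a ++ b ∷ replicate n a ↭ b ∷ replicate (m + n) a
replicate-++-↭ 0 n a b = refl
replicate-++-↭ (suc m) n a b = ↭-trans (prep a (replicate-++-↭ m n a b)) (swap a b refl)

oddOneAt : Fin 6 → Digit → Digit → List Digit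
oddOneAt j a b = replicate (5 ∸ toℕ j) a ++ b ∷ replicate (toℕ j) a

oddOneAt-↭ : ∀ j a b → oddOneAt zero a b ↭ oddOneAt j a b
oddOneAt-↭ j a b = ↭-trans (replicate-++-↭ 5 0 a b) (↭-sym (subst (λ k → oddOneAt j a b ↭ b ∷ replicate k a)
  (m∸n+n≡m (toℕ≤pred[n] j)) (replicate-++-↭ (5 ∸ toℕ j) (toℕ j) a b)))

length-oddOneAt : ∀ j a b → length (oddOneAt j a b) ≡ 6
length-oddOneAt j a b = sym (↭-length (oddOneAt-↭ j a b))

value-++-oddOneAt : ∀ ds j a b → value (ds ++ oddOneAt j a b) ≡ value ds * 10 ^ 6 + value (oddOneAt j a b)
value-++-oddOneAt ds j a b =
  trans (value-++ ds _) (cong (λ k → value ds * 10 ^ k + value (oddOneAt j a b)) (length-oddOneAt j a b))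

oddOneAt-digits-coprime : ∀ ds a b → (∀ j → Coprime (value (ds ++ oddOneAt j a b)) 10) →
                          Coprime (toℕ a) 10 × Coprime (toℕ b) 10
oddOneAt-digits-coprime ds a b coprime =
    coprime-lastDigit (ds ++ a ∷ a ∷ a ∷ a ∷ b ∷ []) a
      (subst Coprime-10 (sym (++-assoc ds (a ∷ a ∷ a ∷ a ∷ b ∷ []) [ a ])) (coprime (fsuc zero)))
  , coprime-lastDigit (ds ++ replicate 5 a) b
      (subst Coprime-10 (sym (++-assoc ds (replicate 5 a) [ b ])) (coprime zero))
  where
  Coprime-10 : List Digit → Set
  Coprime-10 es = Coprime (value es) 10

-- A finite check; by the residue computation above it holds because 111111 ≡ 0 (mod 7),
-- 10 generates (ℤ/7)ˣ, and no two distinct digits in {1, 3, 7, 9} are congruent mod 7.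
sevenDividesSomeOddOneAt : ∀ {r} → r < 7 → r ≢ 0 → (a b : Digit) →
  Coprime (toℕ a) 10 → Coprime (toℕ b) 10 → a ≢ b → ∃[ j ] 7 ∣ r * 10 ^ 6 + value (oddOneAt j a b)
sevenDividesSomeOddOneAt = from-yes (allUpTo? (λ r → ¬? (r Data.Nat.≟ 0) →-dec all? λ a → all? λ b →
  coprime? (toℕ a) 10 →-dec coprime? (toℕ b) 10 →-dec ¬? (a ≟ b) →-dec
  any? λ j → 7 ∣? r * 10 ^ 6 + value (oddOneAt j a b)) 7)

lemma4 : (n : ℕ) → n ≥ 7 →
         (c₁ : Digit) (cs : List Digit) (a b : Digit) →
         length (c₁ ∷ cs) + 6 ≡ n →
         c₁ ≢ zero →
         a ≢ b →
         AbsolutePrime ((c₁ ∷ cs) ++ a ∷ a ∷ a ∷ a ∷ a ∷ b ∷ []) →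
         7 ∣ value (c₁ ∷ cs)
lemma4 _ _ c₁ cs a b _ c₁≢0 a≢b absolutePrime = decidable-stable (7 ∣? K) ¬7∤K
  where
  c = c₁ ∷ cs
  K = value c
  N : Fin 6 → ℕ
  N j = value (c ++ oddOneAt j a b)

  N-prime : ∀ j → Prime (N j)
  N-prime j = absolutePrime _ (++⁺ˡ c (oddOneAt-↭ j a b))

  10<N : ∀ j → 10 < N j
  10<N j = <-≤-trans (^-monoʳ-< 10 (s≤s (s≤s z≤n)) {1} {6} (s≤s (s≤s z≤n)))
    (subst (λ k → 10 ^ k ≤ N j) (length-oddOneAt j a b) (value-++-≥ cs (oddOneAt j a b) c₁≢0))

  coprime-N : ∀ {j n} .{{_ : NonZero n}} → n ≤ 10 → Coprime (N j) n
  coprime-N {j} n≤10 = prime⇒coprime (N-prime j) (≤-<-trans n≤10 (10<N j))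

  digits-coprime : Coprime (toℕ a) 10 × Coprime (toℕ b) 10
  digits-coprime = oddOneAt-digits-coprime c a b (λ j → coprime-N ≤-refl)

  7∤[K%7]*10⁶+T : ∀ j → ¬ 7 ∣ K % 7 * 10 ^ 6 + value (oddOneAt j a b)
  7∤[K%7]*10⁶+T j 7∣ = 7≢1 (coprime-N (≤ᵇ⇒≤ 7 10 _) (7∣N , ∣-refl))
    where
    7≢1 : 7 ≢ 1
    7≢1 ()
    7∣N : 7 ∣ N j
    7∣N = subst (7 ∣_) (sym (value-++-oddOneAt c j a b))
            (∣[m%d]*k+t⇒∣m*k+t K (10 ^ 6) (value (oddOneAt j a b)) 7 7∣)

  ¬7∤K : ¬ ¬ 7 ∣ K
  ¬7∤K 7∤K = uncurry 7∤[K%7]*10⁶+T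
    (sevenDividesSomeOddOneAt (m%n<n K 7) (λ r≡0 → 7∤K (m%n≡0⇒n∣m K 7 r≡0)) a b
      (proj₁ digits-coprime) (proj₂ digits-coprime) a≢b)
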